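{- For every integer $m\ge 2$, the graph $P_m$ is vertex decomposable, and a vertex $v$ belongs to $\mathrm{Shed}(P_m)$ if and only if $v=z_1$ or $v=z_2$.
   Context: For $m\ge2$, $P_m$ is the graph with vertex set $X\cup Y\cup Z$, $X=\{x_1,\ldots,x_{2m}\}$, $Y=\{y_1,y_2\}$, $Z=\{z_1,z_2,z_3\}$, whose edges are exactly: (i) the induced subgraph on $X$ is the complete $m$-partite graph $K_{2,\ldots,2}$ whose complement is the matching $\{x_{2i-1},x_{2i}\}$, $1\le i\le m$; (ii) $y_1$ is adjacent to $z_1$ and to each $x_{2i-1}$, $1\le i\le m$; (iii) $y_2$ is adjacent to $z_2$ and to each $x_{2i}$, $1\le i\le m$; (iv) $Z$ induces a triangle $K_3$. For a graph $G=(V,E)$ and $x\in V$, $G\setminus x$ is the graph obtained by deleting $x$ and its incident edges; $N[x]$ is $x$ together with its neighbours, and $G\setminus N[x]$ is obtained by deleting all vertices of $N[x]$ and their incident edges. A graph is well-covered if all its maximal independent sets have the same cardinality. A graph $G$ is vertex decomposable if $G$ is well-covered and either (i) $G$ has no edges (possibly no vertices), or (ii) there is a vertex $x$ such that both $G\setminus x$ and $G\setminus N[x]$ are vertex decomposable. For a vertex decomposable graph $G$, $\mathrm{Shed}(G)$ is the set of vertices $x$ such that $G\setminus x$ and $G\setminus N[x]$ are both vertex decomposable. -}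

module Defs where

open import Data.Nat using (ℕ; zero; suc; _+_; _*_; _≡ᵇ_; _%_; _/_)
open import Data.Fin using (Fin; zero; suc; toℕ)
open import Data.Fin.Subset using (Subset; _∈_; _∉_; _⊆_; _─_; _-_; ∣_∣; ⊤; inside; outside)
open import Data.Bool using (Bool; true; false; _∧_; _∨_; not; T; if_then_else_)
open import Data.Vec using (tabulate)
open import Data.Product using (_×_; ∃-syntax)
open import Relation.Binary.PropositionalEquality using (_≡_)
open import Relation.Nullary using (¬_)
open import Relation.Nullary.Decidable using (⌊_⌋)
import Data.Fin as F

-- Subgraphs arising from G \ x and G \ N[x] are induced
-- subgraphs, represented by the subset S ⊆ Fin n of remaining vertices.

Adj : ℕ → Set
Adj n = Fin n → Fin n → Bool

module _ {n : ℕ} (adj : Adj n) where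

  Independent : Subset n → Subset n → Set
  Independent S I = I ⊆ S × (∀ u v → u ∈ I → v ∈ I → ¬ T (adj u v))

  MaximalIndependent : Subset n → Subset n → Set
  MaximalIndependent S I =
    Independent S I × (∀ v → v ∈ S → v ∉ I → ∃[ u ] (u ∈ I × T (adj u v)))

  WellCovered : Subset n → Set
  WellCovered S = ∀ I J → MaximalIndependent S I → MaximalIndependent S J → ∣ I ∣ ≡ ∣ J ∣

  NoEdges : Subset n → Set
  NoEdges S = ∀ u v → u ∈ S → v ∈ S → ¬ T (adj u v)

  N[_] : Fin n → Subset n
  N[ x ] = tabulate (λ v → if ⌊ v F.≟ x ⌋ ∨ adj x v then inside else outside)

  data VertexDecomposable (S : Subset n) : Set where
    vd-empty : WellCovered S → NoEdges S → VertexDecomposable S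
    vd-shed  : WellCovered S → (x : Fin n) → x ∈ S →
               VertexDecomposable (S - x) →
               VertexDecomposable (S ─ N[ x ]) →
               VertexDecomposable S

  Shedding : Subset n → Fin n → Set
  Shedding S x = x ∈ S × VertexDecomposable (S - x) × VertexDecomposable (S ─ N[ x ])

-- The graph P_m on Fin (5 + 2m):
--   0 = z₁, 1 = z₂, 2 = z₃, 3 = y₁, 4 = y₂, 5 + i = x_{i+1}  (i : Fin (2m)).
-- So x_{2k-1} (1-based) has even 0-based index i, x_{2k} odd index,
-- and x_{2k-1}, x_{2k} are the pair with equal  i / 2.

data PKind (m : ℕ) : Set where
  kz₁ kz₂ kz₃ ky₁ ky₂ : PKind m
  kx : Fin (2 * m) → PKind m

kind : (m : ℕ) → Fin (5 + 2 * m) → PKind m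
kind m zero = kz₁
kind m (suc zero) = kz₂
kind m (suc (suc zero)) = kz₃
kind m (suc (suc (suc zero))) = ky₁
kind m (suc (suc (suc (suc zero)))) = ky₂
kind m (suc (suc (suc (suc (suc i))))) = kx i

evenᵇ : ℕ → Bool
evenᵇ k = k % 2 ≡ᵇ 0

adjK : {m : ℕ} → PKind m → PKind m → Bool
adjK kz₁ kz₂ = true
adjK kz₁ kz₃ = true
adjK kz₂ kz₁ = true
adjK kz₂ kz₃ = true
adjK kz₃ kz₁ = true
adjK kz₃ kz₂ = true
adjK ky₁ kz₁ = true
adjK kz₁ ky₁ = true
adjK ky₂ kz₂ = true
adjK kz₂ ky₂ = true
-- (ii) y₁ ~ x_{2i-1};  (iii) y₂ ~ x_{2i}
adjK ky₁ (kx i) = evenᵇ (toℕ i)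
adjK (kx i) ky₁ = evenᵇ (toℕ i)
adjK ky₂ (kx i) = not (evenᵇ (toℕ i))
adjK (kx i) ky₂ = not (evenᵇ (toℕ i))
-- (i) X induces K_{2,...,2} with complement the matching {x_{2i-1}, x_{2i}}
adjK (kx i) (kx j) = not (toℕ i ≡ᵇ toℕ j) ∧ not (toℕ i / 2 ≡ᵇ toℕ j / 2)
adjK _ _ = false

P-adj : (m : ℕ) → Adj (5 + 2 * m)
P-adj m u v = adjK (kind m u) (kind m v)

z₁ z₂ : (m : ℕ) → Fin (5 + 2 * m)
z₁ m = zero
z₂ m = suc zero

-- P_m is shed at z₁.  In P_m ∖ z₁ one sheds z₂, which leaves z₃ isolated beside {y₁, y₂} ∪ X, and in
-- {y₁, y₂} ∪ X one sheds y₁, leaving the clique formed by y₂ and its neighbours.  What remains are graphs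
-- {y} ∪ (pairs k, …, m - 1) in which y is adjacent to one vertex of each pair: shedding that vertex of
-- pair k and then its mate leaves {y} ∪ (pairs k + 1, …, m - 1) and singletons, so all of them are
-- vertex decomposable with every maximal independent set of size 2.  Carrying the common size of the
-- maximal independent sets through each shedding step gives well-coveredness along the way.
-- Conversely, vertex decomposability passes to the link G ∖ N[v].  The link of y₁ in P_m ∖ z₃ and
-- the link of a suitable z in P_m ∖ x_a contain a vertex dominating them and a dominating non-edge,
-- i.e. maximal independent sets of sizes 1 and 2; the link of a z in P_m ∖ y is the complete
-- multipartite graph on X, every vertex deletion of which is of that kind.

module Submission where

open import Defs hiding (N[_])
import Defs
open import Data.Bool using (Bool; true; false; T; not; _∧_; _∨_; if_then_else_)
open import Data.Bool.Properties
  using (∧-zeroʳ; ∧-identityʳ; ∧-inverseˡ; not-¬; ¬-not; T-≡; T-not-≡; T-∧; T?)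
  renaming (_≟_ to _≟ᵇ_)
open import Data.Empty using (⊥-elim)
open import Data.Fin using (Fin; zero; suc; toℕ; fromℕ<; _≟_)
open import Data.Fin.Properties using (toℕ-injective; toℕ<n; toℕ-fromℕ<)
open import Data.Fin.Subset
open import Data.Fin.Subset.Properties
  using (x∈⁅x⁆; x∈⁅y⁆⇒x≡y; x∈p∪q⁺; x∈p∪q⁻; x∈p∧x∉q⇒x∈p─q; x∈p∧x≢y⇒x∈p-y; p─q⊆p; p─q─r≡p─r─q;
         p─⊥≡p; ∪-identityʳ; ∪-idem; ⊆-antisym; _∈?_; nonempty?; Empty-unique; ∣⊥∣≡0; ∣⁅x⁆∣≡1; ∈⊤)
open import Data.Nat using (ℕ; zero; suc; _+_; _*_; _<_; _≤_; _≡ᵇ_; _/_; _%_; z≤n; s≤s)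
open import Data.Nat.DivMod using (m≡m%n+[m/n]*n; m%n<n; m<n*o⇒m/o<n; [m+kn]%n≡m%n; m*n/n≡m; +-distrib-/; m*n%n≡0)
open import Data.Nat.Properties
  using (_≤?_; <-cmp; +-comm; +-suc; suc-injective; m<n⇒m<1+n; <⇒≤; <⇒≱; <⇒≢; >⇒≢; <-irrefl; m<m+n;
         ≤-reflexive; *-comm; ≤-trans; +-monoˡ-≤; *-monoˡ-≤; ≤-refl)
  renaming (_≟_ to _≟ℕ_)
open import Data.Product using (_×_; _,_; proj₁; proj₂; ∃-syntax)
open import Data.Sum using (_⊎_; inj₁; inj₂)
open import Data.Vec using (_∷_; lookup; tabulate; here; there)
open import Data.Vec.Properties
  using (lookup-replicate; lookup-zipWith; lookup∘tabulate; tabulate∘lookup; tabulate-cong; []=⇒lookup; lookup⇒[]=)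
open import Function using (_∘_; case_of_)
open import Function.Bundles using (_⇔_; mk⇔; Equivalence)
open import Relation.Binary.Definitions using (tri<; tri≈; tri>)
open import Relation.Binary.PropositionalEquality
  using (_≡_; _≢_; _≗_; refl; sym; trans; cong; cong₂; subst; module ≡-Reasoning)
open import Relation.Nullary using (¬_; does; yes; no; contradiction)
open import Relation.Nullary.Decidable using (⌊_⌋; isYes≗does; dec-true; dec-false; does-⇔)

private variable
  n : ℕ
  p q : Subset n
  v x : Fin n

lookup-─ : ∀ {n} (p q : Subset n) (v : Fin n) → lookup (p ─ q) v ≡ not (lookup q v) ∧ lookup p v
lookup-─ (_ ∷ _) (inside  ∷ _) zero    = refl
lookup-─ (_ ∷ _) (outside ∷ _) zero    = refl
lookup-─ (_ ∷ p) (_       ∷ q) (suc v) = lookup-─ p q v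

lookup-⁅⁆ : ∀ {n} (x v : Fin n) → lookup ⁅ x ⁆ v ≡ does (v ≟ x)
lookup-⁅⁆ zero    zero    = refl
lookup-⁅⁆ zero    (suc v) = lookup-replicate v outside
lookup-⁅⁆ (suc x) zero    = refl
lookup-⁅⁆ (suc x) (suc v) = lookup-⁅⁆ x v

lookup-injective : lookup p ≗ lookup q → p ≡ q
lookup-injective {p = p} {q = q} eq = begin
  p                   ≡⟨ tabulate∘lookup p ⟨
  tabulate (lookup p) ≡⟨ tabulate-cong eq ⟩
  tabulate (lookup q) ≡⟨ tabulate∘lookup q ⟩
  q                   ∎
  where open ≡-Reasoning

∈⇒T-lookup : v ∈ p → T (lookup p v)
∈⇒T-lookup v∈p = Equivalence.from T-≡ ([]=⇒lookup v∈p)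

T-lookup⇒∈ : T (lookup p v) → v ∈ p
T-lookup⇒∈ {p = p} {v = v} t = lookup⇒[]= v p (Equivalence.to T-≡ t)

x∈p─q⇒x∉q : v ∈ p ─ q → v ∉ q
x∈p─q⇒x∉q {p = inside ∷ p} {outside ∷ q} here        ()
x∈p─q⇒x∉q {p = _      ∷ p} {_       ∷ q} (there v∈) (there v∈q) = x∈p─q⇒x∉q v∈ v∈q

x∈p-y⇒x≢y : v ∈ p - x → v ≢ x
x∈p-y⇒x≢y {x = x} v∈ refl = x∈p─q⇒x∉q v∈ (x∈⁅x⁆ x)

∣p∣≡1+∣p-x∣ : x ∈ p → ∣ p ∣ ≡ suc ∣ p - x ∣
∣p∣≡1+∣p-x∣ {x = zero}  {inside  ∷ p} here       = cong (λ r → suc ∣ r ∣) (sym (p─⊥≡p p))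
∣p∣≡1+∣p-x∣ {x = suc x} {inside  ∷ p} (there x∈) = cong suc (∣p∣≡1+∣p-x∣ x∈)
∣p∣≡1+∣p-x∣ {x = suc x} {outside ∷ p} (there x∈) = ∣p∣≡1+∣p-x∣ x∈

∣p∪⁅x⁆∣≡1+∣p∣ : x ∉ p → ∣ p ∪ ⁅ x ⁆ ∣ ≡ suc ∣ p ∣
∣p∪⁅x⁆∣≡1+∣p∣ {x = zero}  {inside  ∷ p} x∉p = contradiction here x∉p
∣p∪⁅x⁆∣≡1+∣p∣ {x = zero}  {outside ∷ p} _   = cong (λ r → suc ∣ r ∣) (∪-identityʳ p)
∣p∪⁅x⁆∣≡1+∣p∣ {x = suc x} {inside  ∷ p} x∉p = cong suc (∣p∪⁅x⁆∣≡1+∣p∣ (x∉p ∘ there))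
∣p∪⁅x⁆∣≡1+∣p∣ {x = suc x} {outside ∷ p} x∉p = ∣p∪⁅x⁆∣≡1+∣p∣ (x∉p ∘ there)

∣⁅x⁆∪⁅y⁆∣≡2 : ∀ {y} → x ≢ y → ∣ ⁅ x ⁆ ∪ ⁅ y ⁆ ∣ ≡ 2
∣⁅x⁆∪⁅y⁆∣≡2 {x = x} x≢y =
  trans (∣p∪⁅x⁆∣≡1+∣p∣ λ y∈⁅x⁆ → x≢y (sym (x∈⁅y⁆⇒x≡y x y∈⁅x⁆))) (cong suc (∣⁅x⁆∣≡1 x))

Empty⇒∣p∣≡0 : Empty p → ∣ p ∣ ≡ 0
Empty⇒∣p∣≡0 {n} e = trans (cong ∣_∣ (Empty-unique e)) (∣⊥∣≡0 n)

-- The vertex sets of the proof are identified by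
-- computing characteristic functions vertex by vertex; they use does rather than ⌊_⌋, since
-- does (suc v ≟ suc x) reduces to does (v ≟ x).
infix 4 _≐_
record _≐_ (p : Subset n) (f : Fin n → Bool) : Set where
  constructor mk≐
  field lookup≗ : lookup p ≗ f

private variable
  f g : Fin n → Bool

≐-≗ : p ≐ f → f ≗ g → p ≐ g
≐-≗ (mk≐ p≗f) f≗g = mk≐ λ v → trans (p≗f v) (f≗g v)

≐-injective : p ≐ f → q ≐ f → p ≡ q
≐-injective (mk≐ p≗f) (mk≐ q≗f) = lookup-injective λ v → trans (p≗f v) (sym (q≗f v))

≐⇒∈ : p ≐ f → T (f v) → v ∈ p
≐⇒∈ {v = v} (mk≐ p≗f) t = T-lookup⇒∈ (subst T (sym (p≗f v)) t)

∈⇒≐ : p ≐ f → v ∈ p → T (f v)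
∈⇒≐ {v = v} (mk≐ p≗f) v∈p = subst T (p≗f v) (∈⇒T-lookup v∈p)

⊆-≐ : p ≐ f → q ≐ g → (∀ v → T (f v) → T (g v)) → p ⊆ q
⊆-≐ p≐f q≐g f⇒g {v} v∈p = ≐⇒∈ q≐g (f⇒g v (∈⇒≐ p≐f v∈p))

⊤-≐ : ⊤ {n} ≐ λ _ → true
⊤-≐ = mk≐ λ v → lookup-replicate v inside

⁅⁆-≐ : (x : Fin n) → ⁅ x ⁆ ≐ λ v → does (v ≟ x)
⁅⁆-≐ x = mk≐ (lookup-⁅⁆ x)

∪-≐ : p ≐ f → q ≐ g → p ∪ q ≐ λ v → f v ∨ g v
∪-≐ {p = p} {q = q} (mk≐ p≗f) (mk≐ q≗g) = mk≐ λ v → trans (lookup-zipWith _∨_ v p q) (cong₂ _∨_ (p≗f v) (q≗g v))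

─≐ : p ≐ f → q ≐ g → p ─ q ≐ λ v → not (g v) ∧ f v
─≐ {p = p} {q = q} (mk≐ p≗f) (mk≐ q≗g) =
  mk≐ λ v → trans (lookup-─ p q v) (cong₂ (λ a b → not a ∧ b) (q≗g v) (p≗f v))

-≐ : (x : Fin n) → p ≐ f → p - x ≐ λ v → not (does (v ≟ x)) ∧ f v
-≐ x p≐f = ─≐ p≐f (⁅⁆-≐ x)

∣p∣≡0⇒Empty : ∣ p ∣ ≡ 0 → Empty p
∣p∣≡0⇒Empty ∣p∣≡0 (x , x∈p) with () ← trans (sym ∣p∣≡0) (∣p∣≡1+∣p-x∣ x∈p)

∣p∣≡1+k⇒Nonempty : ∀ {k} → ∣ p ∣ ≡ suc k → Nonempty p
∣p∣≡1+k⇒Nonempty {p = p} ∣p∣≡1+k with nonempty? p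
... | yes ne = ne
... | no  empty with () ← trans (sym ∣p∣≡1+k) (Empty⇒∣p∣≡0 empty)

module SimpleGraph {n : ℕ} (adj : Adj n)
  (adj-sym : ∀ {u v} → T (adj u v) → T (adj v u))
  (adj-irrefl : ∀ {v} → ¬ T (adj v v)) where

  private variable
    S I J : Subset n
    u w : Fin n
    k : ℕ

  N[_] : Fin n → Subset n
  N[_] = Defs.N[_] adj

  VD : Subset n → Set
  VD = VertexDecomposable adj

  MIS : Subset n → Subset n → Set
  MIS = MaximalIndependent adj

  N[]-≐ : (x : Fin n) → N[ x ] ≐ λ v → does (v ≟ x) ∨ adj x v
  N[]-≐ x = mk≐ λ v → begin
    lookup N[ x ] v                                   ≡⟨ lookup∘tabulate _ v ⟩
    (if ⌊ v ≟ x ⌋ ∨ adj x v then inside else outside) ≡⟨ if-side (⌊ v ≟ x ⌋ ∨ adj x v) ⟩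
    ⌊ v ≟ x ⌋ ∨ adj x v                               ≡⟨ cong (_∨ adj x v) (isYes≗does (v ≟ x)) ⟩
    does (v ≟ x) ∨ adj x v                            ∎
    where
    open ≡-Reasoning
    if-side : (b : Bool) → (if b then inside else outside) ≡ b
    if-side true  = refl
    if-side false = refl

  ─N[]-≐ : (x : Fin n) → S ≐ f → S ─ N[ x ] ≐ λ v → not (does (v ≟ x) ∨ adj x v) ∧ f v
  ─N[]-≐ x S≐f = ─≐ S≐f (N[]-≐ x)

  ∈N[]⁻ : v ∈ N[ x ] → v ≡ x ⊎ T (adj x v)
  ∈N[]⁻ {v} {x} v∈N with v ≟ x | ∈⇒≐ (N[]-≐ x) v∈N
  ... | yes v≡x | _ = inj₁ v≡x
  ... | no  _   | t = inj₂ t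

  ∈N[]⁺ : v ≡ x ⊎ T (adj x v) → v ∈ N[ x ]
  ∈N[]⁺ {v} {x} h = ≐⇒∈ (N[]-≐ x) (by-cases h)
    where
    by-cases : v ≡ x ⊎ T (adj x v) → T (does (v ≟ x) ∨ adj x v)
    by-cases h with v ≟ x | h
    ... | yes _  | _        = _
    ... | no  _  | inj₂ t   = t
    ... | no v≢x | inj₁ v≡x = contradiction v≡x v≢x

  x∈N[x] : x ∈ N[ x ]
  x∈N[x] = ∈N[]⁺ (inj₁ refl)

  S─N[x]⊆S-x : S ─ N[ x ] ⊆ S - x
  S─N[x]⊆S-x v∈ = x∈p∧x≢y⇒x∈p-y (p─q⊆p _ _ v∈) λ { refl → x∈p─q⇒x∉q v∈ x∈N[x] }

  WellCoveredOfSize : Subset n → ℕ → Set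
  WellCoveredOfSize S k = ∀ I → MIS S I → ∣ I ∣ ≡ k

  DecomposableOfSize : Subset n → ℕ → Set
  DecomposableOfSize S k = VD S × WellCoveredOfSize S k

  ofSize⇒wellCovered : WellCoveredOfSize S k → WellCovered adj S
  ofSize⇒wellCovered h I J I-max J-max = trans (h I I-max) (sym (h J J-max))

  VD⇒wellCovered : VD S → WellCovered adj S
  VD⇒wellCovered (vd-empty wc _)       = wc
  VD⇒wellCovered (vd-shed wc _ _ _ _) = wc

  MIS-avoid : x ∉ I → MIS S I → MIS (S - x) I
  MIS-avoid x∉I ((I⊆S , indep) , dom) =
    ((λ v∈I → x∈p∧x≢y⇒x∈p-y (I⊆S v∈I) λ { refl → x∉I v∈I }) , indep) ,
    λ v v∈S-x → dom v (p─q⊆p _ _ v∈S-x)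

  MIS-delete : x ∈ I → MIS S I → MIS (S ─ N[ x ]) (I - x)
  MIS-delete {x} {I} {S} x∈I ((I⊆S , indep) , dom) = (sub , indep′) , dom′
    where
    sub : I - x ⊆ S ─ N[ x ]
    sub {u} u∈ = x∈p∧x∉q⇒x∈p─q (I⊆S (p─q⊆p _ _ u∈)) λ u∈N → case ∈N[]⁻ u∈N of λ where
      (inj₁ u≡x) → x∈p-y⇒x≢y u∈ u≡x
      (inj₂ xu)  → indep x u x∈I (p─q⊆p _ _ u∈) xu
    indep′ : ∀ u v → u ∈ I - x → v ∈ I - x → ¬ T (adj u v)
    indep′ u v u∈ v∈ = indep u v (p─q⊆p _ _ u∈) (p─q⊆p _ _ v∈)
    dom′ : ∀ v → v ∈ S ─ N[ x ] → v ∉ I - x → ∃[ u ] (u ∈ I - x × T (adj u v))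
    dom′ v v∈ v∉ with v ∈? I
    ... | yes v∈I = contradiction (x∈p∧x≢y⇒x∈p-y v∈I λ v≡x → x∈p─q⇒x∉q v∈ (∈N[]⁺ (inj₁ v≡x))) v∉
    ... | no  v∉I with dom v (p─q⊆p _ _ v∈) v∉I
    ... | u , u∈I , uv = u , x∈p∧x≢y⇒x∈p-y u∈I (λ { refl → x∈p─q⇒x∉q v∈ (∈N[]⁺ (inj₂ uv)) }) , uv

  MIS-insert : x ∈ S → MIS (S ─ N[ x ]) J → MIS S (J ∪ ⁅ x ⁆)
  MIS-insert {x} {S} {J} x∈S ((J⊆ , indep) , dom) = (sub , indep′) , dom′
    where
    split : u ∈ J ∪ ⁅ x ⁆ → u ∈ J ⊎ u ≡ x
    split u∈ with x∈p∪q⁻ J ⁅ x ⁆ u∈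
    ... | inj₁ u∈J = inj₁ u∈J
    ... | inj₂ u∈x = inj₂ (x∈⁅y⁆⇒x≡y x u∈x)
    sub : J ∪ ⁅ x ⁆ ⊆ S
    sub u∈ with split u∈
    ... | inj₁ u∈J = p─q⊆p _ _ (J⊆ u∈J)
    ... | inj₂ refl = x∈S
    indep′ : ∀ u v → u ∈ J ∪ ⁅ x ⁆ → v ∈ J ∪ ⁅ x ⁆ → ¬ T (adj u v)
    indep′ u v u∈ v∈ with split u∈ | split v∈
    ... | inj₁ u∈J | inj₁ v∈J = indep u v u∈J v∈J
    ... | inj₁ u∈J | inj₂ refl = λ uv → x∈p─q⇒x∉q (J⊆ u∈J) (∈N[]⁺ (inj₂ (adj-sym uv)))
    ... | inj₂ refl | inj₁ v∈J = λ uv → x∈p─q⇒x∉q (J⊆ v∈J) (∈N[]⁺ (inj₂ uv))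
    ... | inj₂ refl | inj₂ refl = adj-irrefl
    dom′ : ∀ v → v ∈ S → v ∉ J ∪ ⁅ x ⁆ → ∃[ u ] (u ∈ J ∪ ⁅ x ⁆ × T (adj u v))
    dom′ v v∈S v∉ with v ∈? N[ x ]
    ... | yes v∈N = case ∈N[]⁻ v∈N of λ where
      (inj₁ refl) → contradiction (x∈p∪q⁺ (inj₂ (x∈⁅x⁆ x))) v∉
      (inj₂ xv)   → x , x∈p∪q⁺ (inj₂ (x∈⁅x⁆ x)) , xv
    ... | no v∉N with dom v (x∈p∧x∉q⇒x∈p─q v∈S v∉N) (v∉ ∘ x∈p∪q⁺ ∘ inj₁)
    ... | u , u∈J , uv = u , x∈p∪q⁺ (inj₁ u∈J) , uv

  MIS-excludes-N[] : MIS (S ─ N[ x ]) J → x ∉ J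
  MIS-excludes-N[] ((J⊆ , _) , _) x∈J = x∈p─q⇒x∉q (J⊆ x∈J) x∈N[x]

  shed : x ∈ S → DecomposableOfSize (S - x) (suc k) → DecomposableOfSize (S ─ N[ x ]) k →
         DecomposableOfSize S (suc k)
  shed {x} {S} {k} x∈S (vd₁ , size₁) (vd₂ , size₂) = vd-shed (ofSize⇒wellCovered size) x x∈S vd₁ vd₂ , size
    where
    size : WellCoveredOfSize S (suc k)
    size I I-max with x ∈? I
    ... | yes x∈I = trans (∣p∣≡1+∣p-x∣ x∈I) (cong suc (size₂ (I - x) (MIS-delete x∈I I-max)))
    ... | no  x∉I = size₁ I (MIS-avoid x∉I I-max)

  -- An isolated vertex x is characterised by S ─ N[ x ] ≡ S - x.
  shed-isolated : x ∈ S → S ─ N[ x ] ≡ S - x → DecomposableOfSize (S - x) k →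
                  DecomposableOfSize S (suc k)
  shed-isolated {x} {S} {k} x∈S isolated (vd₁ , size₁) =
    vd-shed (ofSize⇒wellCovered size) x x∈S vd₁ (subst VD (sym isolated) vd₁) , size
    where
    size : WellCoveredOfSize S (suc k)
    size I I-max@((I⊆S , _) , dom) with x ∈? I
    ... | yes x∈I = trans (∣p∣≡1+∣p-x∣ x∈I)
                      (cong suc (size₁ (I - x) (subst (λ R → MIS R (I - x)) isolated (MIS-delete x∈I I-max))))
    ... | no  x∉I with dom x x∈S x∉I
    ... | u , u∈I , ux = ⊥-elim (x∈p─q⇒x∉q u∈S─N (∈N[]⁺ (inj₂ (adj-sym ux))))
      where
      u∈S─N : u ∈ S ─ N[ x ]
      u∈S─N = subst (u ∈_) (sym isolated) (x∈p∧x≢y⇒x∈p-y (I⊆S u∈I) λ { refl → x∉I u∈I })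

  edgeless-decomposable : NoEdges adj S → DecomposableOfSize S ∣ S ∣
  edgeless-decomposable {S} no-edges = vd-empty (ofSize⇒wellCovered size) no-edges , size
    where
    size : WellCoveredOfSize S ∣ S ∣
    size I ((I⊆S , _) , dom) = cong ∣_∣ (⊆-antisym I⊆S S⊆I)
      where
      S⊆I : S ⊆ I
      S⊆I {v} v∈S with v ∈? I
      ... | yes v∈I = v∈I
      ... | no  v∉I with dom v v∈S v∉I
      ... | u , u∈I , uv = contradiction uv (no-edges u v (I⊆S u∈I) v∈S)

  empty-decomposable : Empty S → DecomposableOfSize S 0
  empty-decomposable empty = subst (DecomposableOfSize _) (Empty⇒∣p∣≡0 empty)
    (edgeless-decomposable λ u _ u∈ _ _ → empty (u , u∈))

  singleton-decomposable : (x : Fin n) → DecomposableOfSize ⁅ x ⁆ 1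
  singleton-decomposable x = subst (DecomposableOfSize _) (∣⁅x⁆∣≡1 x)
    (edgeless-decomposable λ u v u∈ v∈ →
      subst (λ w → ¬ T (adj u w)) (trans (x∈⁅y⁆⇒x≡y x u∈) (sym (x∈⁅y⁆⇒x≡y x v∈))) adj-irrefl)

  Clique : Subset n → Set
  Clique S = ∀ u v → u ∈ S → v ∈ S → u ≢ v → T (adj u v)

  clique-decomposable : ∀ k → ∣ S ∣ ≡ suc k → Clique S → DecomposableOfSize S 1
  clique-decomposable {S} k ∣S∣≡1+k clique with ∣p∣≡1+k⇒Nonempty ∣S∣≡1+k
  ... | x , x∈S = by-size k (suc-injective (trans (sym (∣p∣≡1+∣p-x∣ x∈S)) ∣S∣≡1+k))
    where
    S─N[x]-empty : Empty (S ─ N[ x ])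
    S─N[x]-empty (v , v∈) = x∈p─q⇒x∉q v∈ (∈N[]⁺ (inj₂ (clique x v x∈S (p─q⊆p _ _ v∈) x≢v)))
      where
      x≢v : x ≢ v
      x≢v refl = x∈p─q⇒x∉q v∈ x∈N[x]
    by-size : ∀ k → ∣ S - x ∣ ≡ k → DecomposableOfSize S 1
    by-size zero    ∣S-x∣≡0 = shed-isolated x∈S
      (trans (Empty-unique S─N[x]-empty) (sym (Empty-unique (∣p∣≡0⇒Empty ∣S-x∣≡0))))
      (empty-decomposable (∣p∣≡0⇒Empty ∣S-x∣≡0))
    by-size (suc k) ∣S-x∣≡1+k = shed x∈S
      (clique-decomposable k ∣S-x∣≡1+k λ u v u∈ v∈ → clique u v (p─q⊆p _ _ u∈) (p─q⊆p _ _ v∈))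
      (empty-decomposable S─N[x]-empty)

  wellCovered-─N[] : WellCovered adj S → x ∈ S → WellCovered adj (S ─ N[ x ])
  wellCovered-─N[] {S} {x} wc x∈S I J I-max J-max = suc-injective (begin
    suc ∣ I ∣       ≡⟨ ∣p∪⁅x⁆∣≡1+∣p∣ (MIS-excludes-N[] I-max) ⟨
    ∣ I ∪ ⁅ x ⁆ ∣   ≡⟨ wc _ _ (MIS-insert x∈S I-max) (MIS-insert x∈S J-max) ⟩
    ∣ J ∪ ⁅ x ⁆ ∣   ≡⟨ ∣p∪⁅x⁆∣≡1+∣p∣ (MIS-excludes-N[] J-max) ⟩
    suc ∣ J ∣       ∎)
    where open ≡-Reasoning

  ─N[]-absorbs-neighbour : T (adj x v) → (S - v) ─ N[ x ] ≡ S ─ N[ x ]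
  ─N[]-absorbs-neighbour xv = ⊆-antisym
    (λ u∈ → x∈p∧x∉q⇒x∈p─q (p─q⊆p _ _ (p─q⊆p _ _ u∈)) (x∈p─q⇒x∉q u∈))
    (λ u∈ → x∈p∧x∉q⇒x∈p─q
      (x∈p∧x≢y⇒x∈p-y (p─q⊆p _ _ u∈) λ { refl → x∈p─q⇒x∉q u∈ (∈N[]⁺ (inj₂ xv)) })
      (x∈p─q⇒x∉q u∈))

  -- Induction on the decomposition: a shedding vertex v ∉ N[ x ] of S still sheds S ─ N[ x ].
  VD-─N[] : VD S → x ∈ S → VD (S ─ N[ x ])
  VD-─N[] (vd-empty wc no-edges) x∈S =
    vd-empty (wellCovered-─N[] wc x∈S) λ u v u∈ v∈ → no-edges u v (p─q⊆p _ _ u∈) (p─q⊆p _ _ v∈)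
  VD-─N[] {S} {x} (vd-shed wc v v∈S vd₁ vd₂) x∈S with x ≟ v
  ... | yes refl = vd₂
  ... | no  x≢v with T? (adj x v)
  ...   | yes xv = subst VD (─N[]-absorbs-neighbour xv) (VD-─N[] vd₁ (x∈p∧x≢y⇒x∈p-y x∈S x≢v))
  ...   | no ¬xv = vd-shed (wellCovered-─N[] wc x∈S) v v∈S─N[x]
    (subst VD (p─q─r≡p─r─q S ⁅ v ⁆ N[ x ]) (VD-─N[] vd₁ (x∈p∧x≢y⇒x∈p-y x∈S x≢v)))
    (subst VD (p─q─r≡p─r─q S N[ v ] N[ x ]) (VD-─N[] vd₂ (x∈p∧x∉q⇒x∈p─q x∈S x∉N[v])))
    where
    v∈S─N[x] : v ∈ S ─ N[ x ]
    v∈S─N[x] = x∈p∧x∉q⇒x∈p─q v∈S λ v∈N → case ∈N[]⁻ v∈N of λ where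
      (inj₁ v≡x) → x≢v (sym v≡x)
      (inj₂ xv)  → ¬xv xv
    x∉N[v] : x ∉ N[ v ]
    x∉N[v] x∈N = case ∈N[]⁻ x∈N of λ where
      (inj₁ x≡v) → x≢v x≡v
      (inj₂ vx)  → ¬xv (adj-sym vx)

  ⁅u⁆∪⁅w⁆-maximal : u ∈ S → w ∈ S → ¬ T (adj u w) → S ⊆ N[ u ] ∪ N[ w ] → MIS S (⁅ u ⁆ ∪ ⁅ w ⁆)
  ⁅u⁆∪⁅w⁆-maximal {u} {S} {w} u∈S w∈S ¬uw S⊆N[u]∪N[w] = (sub , indep) , dom
    where
    split : v ∈ ⁅ u ⁆ ∪ ⁅ w ⁆ → v ≡ u ⊎ v ≡ w
    split v∈ with x∈p∪q⁻ ⁅ u ⁆ ⁅ w ⁆ v∈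
    ... | inj₁ v∈u = inj₁ (x∈⁅y⁆⇒x≡y u v∈u)
    ... | inj₂ v∈w = inj₂ (x∈⁅y⁆⇒x≡y w v∈w)
    u∈ : u ∈ ⁅ u ⁆ ∪ ⁅ w ⁆
    u∈ = x∈p∪q⁺ (inj₁ (x∈⁅x⁆ u))
    w∈ : w ∈ ⁅ u ⁆ ∪ ⁅ w ⁆
    w∈ = x∈p∪q⁺ (inj₂ (x∈⁅x⁆ w))
    sub : ⁅ u ⁆ ∪ ⁅ w ⁆ ⊆ S
    sub v∈ with split v∈
    ... | inj₁ refl = u∈S
    ... | inj₂ refl = w∈S
    indep : ∀ a b → a ∈ ⁅ u ⁆ ∪ ⁅ w ⁆ → b ∈ ⁅ u ⁆ ∪ ⁅ w ⁆ → ¬ T (adj a b)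
    indep a b a∈ b∈ with split a∈ | split b∈
    ... | inj₁ refl | inj₁ refl = adj-irrefl
    ... | inj₁ refl | inj₂ refl = ¬uw
    ... | inj₂ refl | inj₁ refl = ¬uw ∘ adj-sym
    ... | inj₂ refl | inj₂ refl = adj-irrefl
    dom : ∀ v → v ∈ S → v ∉ ⁅ u ⁆ ∪ ⁅ w ⁆ → ∃[ a ] (a ∈ ⁅ u ⁆ ∪ ⁅ w ⁆ × T (adj a v))
    dom v v∈S v∉ with x∈p∪q⁻ N[ u ] N[ w ] (S⊆N[u]∪N[w] v∈S)
    ... | inj₁ v∈N[u] = case ∈N[]⁻ v∈N[u] of λ where
      (inj₁ refl) → contradiction u∈ v∉
      (inj₂ uv)   → u , u∈ , uv
    ... | inj₂ v∈N[w] = case ∈N[]⁻ v∈N[w] of λ where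
      (inj₁ refl) → contradiction w∈ v∉
      (inj₂ wv)   → w , w∈ , wv

  ⁅x⁆-maximal : x ∈ S → S ⊆ N[ x ] → MIS S ⁅ x ⁆
  ⁅x⁆-maximal {x} {S} x∈S S⊆N[x] = subst (MIS S) (∪-idem ⁅ x ⁆)
    (⁅u⁆∪⁅w⁆-maximal x∈S x∈S adj-irrefl (x∈p∪q⁺ ∘ inj₁ ∘ S⊆N[x]))

  dominating-vertex-and-pair⇒¬wellCovered :
    x ∈ S → S ⊆ N[ x ] →
    u ∈ S → w ∈ S → u ≢ w → ¬ T (adj u w) → S ⊆ N[ u ] ∪ N[ w ] →
    ¬ WellCovered adj S
  dominating-vertex-and-pair⇒¬wellCovered {x} {S} {u} {w} x∈S S⊆N[x] u∈S w∈S u≢w ¬uw S⊆N[u]∪N[w] wc =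
    case begin
      1                    ≡⟨ ∣⁅x⁆∣≡1 x ⟨
      ∣ ⁅ x ⁆ ∣             ≡⟨ wc _ _ (⁅x⁆-maximal x∈S S⊆N[x]) (⁅u⁆∪⁅w⁆-maximal u∈S w∈S ¬uw S⊆N[u]∪N[w]) ⟩
      ∣ ⁅ u ⁆ ∪ ⁅ w ⁆ ∣     ≡⟨ ∣⁅x⁆∪⁅y⁆∣≡2 u≢w ⟩
      2                    ∎
    of λ ()
    where open ≡-Reasoning

-- x_{i+1} lies in pair i / 2; parity true marks x_{2k+1}, the member of pair k adjacent to y₁.
module Pairing (m : ℕ) where

  pair : Fin (2 * m) → ℕ
  pair i = toℕ i / 2

  parity : Fin (2 * m) → Bool
  parity i = evenᵇ (toℕ i)

  bit : Bool → ℕ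
  bit true  = 0
  bit false = 1

  %2≡bit-evenᵇ : ∀ n → n % 2 ≡ bit (evenᵇ n)
  %2≡bit-evenᵇ n with n % 2 | m%n<n n 2
  ... | 0 | _ = refl
  ... | 1 | _ = refl
  ... | suc (suc _) | s≤s (s≤s ())

  toℕ-pair-parity : ∀ i → toℕ i ≡ bit (parity i) + pair i * 2
  toℕ-pair-parity i = trans (m≡m%n+[m/n]*n (toℕ i) 2) (cong (_+ pair i * 2) (%2≡bit-evenᵇ (toℕ i)))

  pair-parity-injective : ∀ {i j} → pair i ≡ pair j → parity i ≡ parity j → i ≡ j
  pair-parity-injective {i} {j} same-pair same-parity = toℕ-injective (begin
    toℕ i                          ≡⟨ toℕ-pair-parity i ⟩
    bit (parity i) + pair i * 2    ≡⟨ cong₂ (λ b k → bit b + k * 2) same-parity same-pair ⟩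
    bit (parity j) + pair j * 2    ≡⟨ toℕ-pair-parity j ⟨
    toℕ j                          ∎)
    where open ≡-Reasoning

  pair<m : ∀ i → pair i < m
  pair<m i = m<n*o⇒m/o<n (subst (toℕ i <_) (*-comm 2 m) (toℕ<n i))

  private
    index<2m : ∀ {k} b → k < m → bit b + k * 2 < 2 * m
    index<2m {k} b k<m = subst (bit b + k * 2 <_) (*-comm m 2)
      (≤-trans (s≤s (+-monoˡ-≤ (k * 2) (bit≤1 b))) (*-monoˡ-≤ 2 k<m))
      where
      bit≤1 : ∀ b → bit b ≤ 1
      bit≤1 true  = z≤n
      bit≤1 false = s≤s z≤n

  member : (k : ℕ) → Bool → k < m → Fin (2 * m)
  member k b k<m = fromℕ< (index<2m b k<m)

  parity-member : ∀ k b k<m → parity (member k b k<m) ≡ b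
  parity-member k b k<m rewrite toℕ-fromℕ< (index<2m b k<m) =
    trans (cong (_≡ᵇ 0) ([m+kn]%n≡m%n (bit b) k 2)) (bit-even b)
    where
    bit-even : ∀ b → (bit b % 2 ≡ᵇ 0) ≡ b
    bit-even true  = refl
    bit-even false = refl

  pair-member : ∀ k b k<m → pair (member k b k<m) ≡ k
  pair-member k b k<m rewrite toℕ-fromℕ< (index<2m b k<m) = half b
    where
    half : ∀ b → (bit b + k * 2) / 2 ≡ k
    half true  = m*n/n≡m k 2
    half false = trans (+-distrib-/ 1 (k * 2) (subst (λ r → 1 + r < 2) (sym (m*n%n≡0 k 2)) ≤-refl)) (m*n/n≡m k 2)

  member-unique : ∀ {k b} k<m i → pair i ≡ k → parity i ≡ b → i ≡ member k b k<m
  member-unique {k} {b} k<m i refl refl = pair-parity-injective (sym (pair-member k b k<m)) (sym (parity-member k b k<m))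

  adjK-same-pair : ∀ i j → pair i ≡ pair j → adjK {m} (kx i) (kx j) ≡ false
  adjK-same-pair i j same =
    trans (cong (λ b → not (toℕ i ≡ᵇ toℕ j) ∧ not b) (dec-true (pair i ≟ℕ pair j) same)) (∧-zeroʳ _)

  adjK-other-pair : ∀ i j → pair i ≢ pair j → adjK {m} (kx i) (kx j) ≡ true
  adjK-other-pair i j other = cong₂ (λ a b → not a ∧ not b)
    (dec-false (toℕ i ≟ℕ toℕ j) (other ∘ cong (_/ 2))) (dec-false (pair i ≟ℕ pair j) other)

adjK-sym : ∀ {m} (a b : PKind m) → adjK a b ≡ adjK b a
adjK-sym kz₁    = λ { kz₁ → refl ; kz₂ → refl ; kz₃ → refl ; ky₁ → refl ; ky₂ → refl ; (kx _) → refl }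
adjK-sym kz₂    = λ { kz₁ → refl ; kz₂ → refl ; kz₃ → refl ; ky₁ → refl ; ky₂ → refl ; (kx _) → refl }
adjK-sym kz₃    = λ { kz₁ → refl ; kz₂ → refl ; kz₃ → refl ; ky₁ → refl ; ky₂ → refl ; (kx _) → refl }
adjK-sym ky₁    = λ { kz₁ → refl ; kz₂ → refl ; kz₃ → refl ; ky₁ → refl ; ky₂ → refl ; (kx _) → refl }
adjK-sym ky₂    = λ { kz₁ → refl ; kz₂ → refl ; kz₃ → refl ; ky₁ → refl ; ky₂ → refl ; (kx _) → refl }
adjK-sym (kx i) = λ { kz₁ → refl ; kz₂ → refl ; kz₃ → refl ; ky₁ → refl ; ky₂ → refl ;
                      (kx j) → cong₂ (λ a b → not a ∧ not b) (≡ᵇ-sym (toℕ i) (toℕ j)) (≡ᵇ-sym (toℕ i / 2) (toℕ j / 2)) }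
  where
  ≡ᵇ-sym : ∀ a b → (a ≡ᵇ b) ≡ (b ≡ᵇ a)
  ≡ᵇ-sym a b = does-⇔ (mk⇔ sym sym) (a ≟ℕ b) (b ≟ℕ a)

adjK-irrefl : ∀ {m} (a : PKind m) → adjK a a ≡ false
adjK-irrefl kz₁ = refl
adjK-irrefl kz₂ = refl
adjK-irrefl kz₃ = refl
adjK-irrefl ky₁ = refl
adjK-irrefl ky₂ = refl
adjK-irrefl (kx i) = cong (λ b → not b ∧ not (toℕ i / 2 ≡ᵇ toℕ i / 2)) (dec-true (toℕ i ≟ℕ toℕ i) refl)

pattern Z₁  = zero
pattern Z₂  = suc zero
pattern Z₃  = suc (suc zero)
pattern Y₁  = suc (suc (suc zero))
pattern Y₂  = suc (suc (suc (suc zero)))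
pattern X i = suc (suc (suc (suc (suc i))))

module P (m : ℕ) where

  open Pairing m public

  V : Set
  V = Fin (5 + 2 * m)

  open SimpleGraph (P-adj m)
    (λ {u} {v} → subst T (adjK-sym (kind m u) (kind m v)))
    (λ {v} → subst T (adjK-irrefl (kind m v))) public

  Y : Bool → V
  Y true  = Y₁
  Y false = Y₂

  Tail : Bool → ℕ → V → Bool
  Tail b k Y₁    = b
  Tail b k Y₂    = not b
  Tail b k (X i) = does (k ≤? pair i)
  Tail b k _     = false

  YOnly : Bool → V → Bool
  YOnly b Y₁ = b
  YOnly b Y₂ = not b
  YOnly b _  = false

  ⁅Y⁆-≐ : ∀ b → ⁅ Y b ⁆ ≐ YOnly b
  ⁅Y⁆-≐ b = ≐-≗ (⁅⁆-≐ (Y b)) (by-vertex b)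
    where
    by-vertex : ∀ b → (λ v → does (v ≟ Y b)) ≗ YOnly b
    by-vertex true  = λ { Z₁ → refl ; Z₂ → refl ; Z₃ → refl ; Y₁ → refl ; Y₂ → refl ; (X _) → refl }
    by-vertex false = λ { Z₁ → refl ; Z₂ → refl ; Z₃ → refl ; Y₁ → refl ; Y₂ → refl ; (X _) → refl }

  Tail-m≗YOnly : ∀ b → Tail b m ≗ YOnly b
  Tail-m≗YOnly b Z₁    = refl
  Tail-m≗YOnly b Z₂    = refl
  Tail-m≗YOnly b Z₃    = refl
  Tail-m≗YOnly b Y₁    = refl
  Tail-m≗YOnly b Y₂    = refl
  Tail-m≗YOnly b (X i) = dec-false (m ≤? pair i) (<⇒≱ (pair<m i))

  data Position (k : ℕ) (b : Bool) (k<m : k < m) : Fin (2 * m) → Set where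
    before : ∀ {i} → pair i < k → Position k b k<m i
    this   : Position k b k<m (member k b k<m)
    mate   : Position k b k<m (member k (not b) k<m)
    after  : ∀ {i} → k < pair i → Position k b k<m i

  position : ∀ k b k<m i → Position k b k<m i
  position k b k<m i with <-cmp (pair i) k
  ... | tri< i<k _ _ = before i<k
  ... | tri> _ _ k<i = after k<i
  ... | tri≈ _ same _ with parity i ≟ᵇ b
  ...   | yes par = subst (Position k b k<m) (sym (member-unique k<m i same par)) this
  ...   | no  par = subst (Position k b k<m) (sym (member-unique k<m i same (¬-not par))) mate

  module PairFacts (b : Bool) (k : ℕ) (k<m : k < m) where

    a a′ : Fin (2 * m)
    a  = member k b k<m
    a′ = member k (not b) k<m

    a′≢a : a′ ≢ a
    a′≢a a′≡a = not-¬ (trans (cong parity a′≡a) (parity-member k b k<m)) (parity-member k (not b) k<m)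

    a≢a′ : a ≢ a′
    a≢a′ = a′≢a ∘ sym

    same-pair : pair a ≡ pair a′
    same-pair = trans (pair-member k b k<m) (sym (pair-member k (not b) k<m))

    module _ (i : Fin (2 * m)) (other : pair i ≢ k) where

      i≟a : does (i ≟ a) ≡ false
      i≟a = dec-false (i ≟ a) λ { refl → other (pair-member k b k<m) }

      i≟a′ : does (i ≟ a′) ≡ false
      i≟a′ = dec-false (i ≟ a′) λ { refl → other (pair-member k (not b) k<m) }

      a~i : adjK {m} (kx a) (kx i) ≡ true
      a~i = adjK-other-pair a i λ eq → other (trans (sym eq) (pair-member k b k<m))

      a′~i : adjK {m} (kx a′) (kx i) ≡ true
      a′~i = adjK-other-pair a′ i λ eq → other (trans (sym eq) (pair-member k (not b) k<m))

    a≟a : does (a ≟ a) ≡ true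
    a≟a = dec-true (a ≟ a) refl

    a′≟a′ : does (a′ ≟ a′) ≡ true
    a′≟a′ = dec-true (a′ ≟ a′) refl

    a≟a′ : does (a ≟ a′) ≡ false
    a≟a′ = dec-false (a ≟ a′) a≢a′

    a′≟a : does (a′ ≟ a) ≡ false
    a′≟a = dec-false (a′ ≟ a) a′≢a

    a≁a′ : adjK {m} (kx a) (kx a′) ≡ false
    a≁a′ = adjK-same-pair a a′ same-pair

    a′≁a : adjK {m} (kx a′) (kx a) ≡ false
    a′≁a = adjK-same-pair a′ a (sym same-pair)

    k≤a : does (k ≤? pair a) ≡ true
    k≤a = dec-true (k ≤? pair a) (≤-reflexive (sym (pair-member k b k<m)))

    k≤a′ : does (k ≤? pair a′) ≡ true
    k≤a′ = dec-true (k ≤? pair a′) (≤-reflexive (sym (pair-member k (not b) k<m)))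

    1+k≰a : does (suc k ≤? pair a) ≡ false
    1+k≰a = dec-false (suc k ≤? pair a) (<-irrefl (sym (pair-member k b k<m)))

    1+k≰a′ : does (suc k ≤? pair a′) ≡ false
    1+k≰a′ = dec-false (suc k ≤? pair a′) (<-irrefl (sym (pair-member k (not b) k<m)))

    module _ (i : Fin (2 * m)) (i<k : pair i < k) where

      k≰i : does (k ≤? pair i) ≡ false
      k≰i = dec-false (k ≤? pair i) (<⇒≱ i<k)

      1+k≰i : does (suc k ≤? pair i) ≡ false
      1+k≰i = dec-false (suc k ≤? pair i) (<⇒≱ (m<n⇒m<1+n i<k))

    module _ (i : Fin (2 * m)) (k<i : k < pair i) where

      k≤i : does (k ≤? pair i) ≡ true
      k≤i = dec-true (k ≤? pair i) (<⇒≤ k<i)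

      1+k≤i : does (suc k ≤? pair i) ≡ true
      1+k≤i = dec-true (suc k ≤? pair i) k<i

    not-not-∧ : ∀ c → not (not c) ∧ c ≡ c
    not-not-∧ true  = refl
    not-not-∧ false = refl

    Tail-─N[a] : (λ v → not (does (v ≟ X a) ∨ P-adj m (X a) v) ∧ Tail b k v) ≗ (λ v → does (v ≟ X a′))
    Tail-─N[a] Z₁ = refl
    Tail-─N[a] Z₂ = refl
    Tail-─N[a] Z₃ = refl
    Tail-─N[a] Y₁ = trans (cong (λ c → not c ∧ b) (parity-member k b k<m)) (∧-inverseˡ b)
    Tail-─N[a] Y₂ = trans (cong (λ c → not (not c) ∧ not b) (parity-member k b k<m)) (∧-inverseˡ (not b))
    Tail-─N[a] (X i) with position k b k<m i
    ... | before i<k rewrite i≟a i (<⇒≢ i<k) | a~i i (<⇒≢ i<k) | i≟a′ i (<⇒≢ i<k) = refl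
    ... | this       rewrite a≟a | a≟a′ = refl
    ... | mate       rewrite a′≟a | a≁a′ | k≤a′ | a′≟a′ = refl
    ... | after k<i  rewrite i≟a i (>⇒≢ k<i) | a~i i (>⇒≢ k<i) | i≟a′ i (>⇒≢ k<i) = refl

    Tail-a-─N[a′] : (λ v → not (does (v ≟ X a′) ∨ P-adj m (X a′) v) ∧ (not (does (v ≟ X a)) ∧ Tail b k v))
                    ≗ YOnly b
    Tail-a-─N[a′] Z₁ = refl
    Tail-a-─N[a′] Z₂ = refl
    Tail-a-─N[a′] Z₃ = refl
    Tail-a-─N[a′] Y₁ = trans (cong (λ c → not c ∧ b) (parity-member k (not b) k<m)) (not-not-∧ b)
    Tail-a-─N[a′] Y₂ = trans (cong (λ c → not (not c) ∧ not b) (parity-member k (not b) k<m)) (not-not-∧ (not b))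
    Tail-a-─N[a′] (X i) with position k b k<m i
    ... | before i<k rewrite i≟a′ i (<⇒≢ i<k) | a′~i i (<⇒≢ i<k) = refl
    ... | this       rewrite a≟a′ | a′≁a | a≟a = refl
    ... | mate       rewrite a′≟a′ = refl
    ... | after k<i  rewrite i≟a′ i (>⇒≢ k<i) | a′~i i (>⇒≢ k<i) = refl

    Tail-a-a′ : (λ v → not (does (v ≟ X a′)) ∧ (not (does (v ≟ X a)) ∧ Tail b k v)) ≗ Tail b (suc k)
    Tail-a-a′ Z₁ = refl
    Tail-a-a′ Z₂ = refl
    Tail-a-a′ Z₃ = refl
    Tail-a-a′ Y₁ = refl
    Tail-a-a′ Y₂ = refl
    Tail-a-a′ (X i) with position k b k<m i
    ... | before i<k rewrite i≟a′ i (<⇒≢ i<k) | i≟a i (<⇒≢ i<k) | k≰i i i<k | 1+k≰i i i<k = refl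
    ... | this       rewrite a≟a′ | a≟a | 1+k≰a = refl
    ... | mate       rewrite a′≟a′ | 1+k≰a′ = refl
    ... | after k<i  rewrite i≟a′ i (>⇒≢ k<i) | i≟a i (>⇒≢ k<i) | k≤i i k<i | 1+k≤i i k<i = refl

  Tail-decomposable : ∀ b r k → k + suc r ≡ m → ∀ {S} → S ≐ Tail b k → DecomposableOfSize S 2
  Tail-decomposable b r k k+1+r≡m {S} S≐Tail = shed Xa∈S (S-a-decomposable r k+1+r≡m)
    (subst (λ R → DecomposableOfSize R 1) (sym S─N[a]≡⁅a′⁆) (singleton-decomposable (X a′)))
    where
    k<m : k < m
    k<m = subst (k <_) k+1+r≡m (m<m+n k (s≤s z≤n))
    open PairFacts b k k<m

    Xa∈S : X a ∈ S
    Xa∈S = ≐⇒∈ S≐Tail (subst T (sym k≤a) _)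

    S─N[a]≡⁅a′⁆ : S ─ N[ X a ] ≡ ⁅ X a′ ⁆
    S─N[a]≡⁅a′⁆ = ≐-injective (≐-≗ (─N[]-≐ (X a) S≐Tail) Tail-─N[a]) (⁅⁆-≐ (X a′))

    Xa′∈S-a : X a′ ∈ S - X a
    Xa′∈S-a = S─N[x]⊆S-x {x = X a} (subst (X a′ ∈_) (sym S─N[a]≡⁅a′⁆) (x∈⁅x⁆ (X a′)))

    S-a─N[a′]≡⁅y⁆ : S - X a ─ N[ X a′ ] ≡ ⁅ Y b ⁆
    S-a─N[a′]≡⁅y⁆ = ≐-injective (≐-≗ (─N[]-≐ (X a′) (-≐ (X a) S≐Tail)) Tail-a-─N[a′]) (⁅Y⁆-≐ b)

    S-a-a′≐Tail : S - X a - X a′ ≐ Tail b (suc k)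
    S-a-a′≐Tail = ≐-≗ (-≐ (X a′) (-≐ (X a) S≐Tail)) Tail-a-a′

    S-a-decomposable : ∀ r → k + suc r ≡ m → DecomposableOfSize (S - X a) 2
    S-a-decomposable zero k+1≡m = shed-isolated Xa′∈S-a (trans S-a─N[a′]≡⁅y⁆ (sym S-a-a′≡⁅y⁆))
      (subst (λ R → DecomposableOfSize R 1) (sym S-a-a′≡⁅y⁆) (singleton-decomposable (Y b)))
      where
      S-a-a′≡⁅y⁆ : S - X a - X a′ ≡ ⁅ Y b ⁆
      S-a-a′≡⁅y⁆ = ≐-injective
        (≐-≗ S-a-a′≐Tail (subst (λ l → Tail b l ≗ YOnly b) (sym (trans (+-comm 1 k) k+1≡m)) (Tail-m≗YOnly b)))
        (⁅Y⁆-≐ b)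
    S-a-decomposable (suc r) k+2+r≡m = shed Xa′∈S-a
      (Tail-decomposable b r (suc k) (trans (sym (+-suc k (suc r))) k+2+r≡m) S-a-a′≐Tail)
      (subst (λ R → DecomposableOfSize R 1) (sym S-a─N[a′]≡⁅y⁆) (singleton-decomposable (Y b)))

  Y₂Clique : V → Bool
  Y₂Clique Y₂    = true
  Y₂Clique (X i) = not (parity i)
  Y₂Clique _     = false

  YsAndXs : V → Bool
  YsAndXs Y₁    = true
  YsAndXs Y₂    = true
  YsAndXs (X _) = true
  YsAndXs _     = false

  Z₃YsAndXs : V → Bool
  Z₃YsAndXs Z₃ = true
  Z₃YsAndXs v  = YsAndXs v

  Y₂Clique-clique : ∀ {S} → S ≐ Y₂Clique → Clique S
  Y₂Clique-clique S≐ u v u∈S v∈S u≢v with u | v | ∈⇒≐ S≐ u∈S | ∈⇒≐ S≐ v∈S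
  ... | Y₂  | Y₂  | _  | _  = ⊥-elim (u≢v refl)
  ... | Y₂  | X j | _  | t  = t
  ... | X i | Y₂  | t  | _  = t
  ... | X i | X j | tᵢ | tⱼ = subst T (sym (adjK-other-pair i j λ same → u≢v (cong X
        (pair-parity-injective same (trans (Equivalence.to T-not-≡ tᵢ) (sym (Equivalence.to T-not-≡ tⱼ)))))))
        _

  -- z true = z₁ is the z adjacent to y true = y₁
  Z : Bool → V
  Z true  = Z₁
  Z false = Z₂

  ⊤─N[z]≐Tail : ∀ c → ⊤ ─ N[ Z c ] ≐ Tail (not c) 0
  ⊤─N[z]≐Tail c = ≐-≗ (─N[]-≐ (Z c) ⊤-≐) (by-vertex c)
    where
    by-vertex : ∀ c → (λ v → not (does (v ≟ Z c) ∨ P-adj m (Z c) v) ∧ true) ≗ Tail (not c) 0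
    by-vertex true  = λ { Z₁ → refl ; Z₂ → refl ; Z₃ → refl ; Y₁ → refl ; Y₂ → refl ; (X _) → refl }
    by-vertex false = λ { Z₁ → refl ; Z₂ → refl ; Z₃ → refl ; Y₁ → refl ; Y₂ → refl ; (X _) → refl }

  ⊤-z-z≐Z₃YsAndXs : ∀ c → ⊤ - Z c - Z (not c) ≐ Z₃YsAndXs
  ⊤-z-z≐Z₃YsAndXs c = ≐-≗ (-≐ (Z (not c)) (-≐ (Z c) ⊤-≐)) (by-vertex c)
    where
    by-vertex : ∀ c → (λ v → not (does (v ≟ Z (not c))) ∧ (not (does (v ≟ Z c)) ∧ true)) ≗ Z₃YsAndXs
    by-vertex true  = λ { Z₁ → refl ; Z₂ → refl ; Z₃ → refl ; Y₁ → refl ; Y₂ → refl ; (X _) → refl }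
    by-vertex false = λ { Z₁ → refl ; Z₂ → refl ; Z₃ → refl ; Y₁ → refl ; Y₂ → refl ; (X _) → refl }

  z~z : ∀ c → T (P-adj m (Z (not c)) (Z c))
  z~z true  = _
  z~z false = _

  module _ (r : ℕ) (1+r≡m : suc r ≡ m) where

    YsAndXs-decomposable : ∀ {S} → S ≐ YsAndXs → DecomposableOfSize S 2
    YsAndXs-decomposable {S} S≐ = shed {x = Y₁} (≐⇒∈ S≐ _)
      (Tail-decomposable false r 0 1+r≡m (≐-≗ (-≐ Y₁ S≐)
        λ { Z₁ → refl ; Z₂ → refl ; Z₃ → refl ; Y₁ → refl ; Y₂ → refl ; (X _) → refl }))
      (clique-decomposable _ (∣p∣≡1+∣p-x∣ {x = Y₂} (≐⇒∈ clique≐ _)) (Y₂Clique-clique clique≐))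
      where
      clique≐ : S ─ N[ Y₁ ] ≐ Y₂Clique
      clique≐ = ≐-≗ (─N[]-≐ Y₁ S≐)
        λ { Z₁ → refl ; Z₂ → refl ; Z₃ → refl ; Y₁ → refl ; Y₂ → refl ; (X _) → ∧-identityʳ _ }

    Z₃YsAndXs-decomposable : ∀ {S} → S ≐ Z₃YsAndXs → DecomposableOfSize S 3
    Z₃YsAndXs-decomposable {S} S≐ =
      shed-isolated {x = Z₃} (≐⇒∈ S≐ _) (≐-injective S─N[z₃]≐ S-z₃≐) (YsAndXs-decomposable S-z₃≐)
      where
      S-z₃≐ : S - Z₃ ≐ YsAndXs
      S-z₃≐ = ≐-≗ (-≐ Z₃ S≐)
        λ { Z₁ → refl ; Z₂ → refl ; Z₃ → refl ; Y₁ → refl ; Y₂ → refl ; (X _) → refl }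
      S─N[z₃]≐ : S ─ N[ Z₃ ] ≐ YsAndXs
      S─N[z₃]≐ = ≐-≗ (─N[]-≐ Z₃ S≐)
        λ { Z₁ → refl ; Z₂ → refl ; Z₃ → refl ; Y₁ → refl ; Y₂ → refl ; (X _) → refl }

    ⊤-z-decomposable : ∀ c → DecomposableOfSize (⊤ - Z c) 3
    ⊤-z-decomposable c = shed {x = Z (not c)} (x∈p∧x≢y⇒x∈p-y ∈⊤ (z≢z c))
      (Z₃YsAndXs-decomposable (⊤-z-z≐Z₃YsAndXs c))
      (subst (λ S → DecomposableOfSize S 2) (sym (─N[]-absorbs-neighbour {x = Z (not c)} (z~z c)))
        (Tail-decomposable (not (not c)) r 0 1+r≡m (⊤─N[z]≐Tail (not c))))
      where
      z≢z : ∀ c → Z (not c) ≢ Z c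
      z≢z true  ()
      z≢z false ()

    z-shedding : ∀ c → Shedding (P-adj m) ⊤ (Z c)
    z-shedding c =
      ∈⊤ , proj₁ (⊤-z-decomposable c) , proj₁ (Tail-decomposable (not c) r 0 1+r≡m (⊤─N[z]≐Tail c))

    ⊤-decomposable : DecomposableOfSize ⊤ 3
    ⊤-decomposable =
      shed {x = Z₁} ∈⊤ (⊤-z-decomposable true) (Tail-decomposable false r 0 1+r≡m (⊤─N[z]≐Tail true))

  XsAnd : Bool → Bool → V → Bool
  XsAnd w c Y₁    = w ∧ c
  XsAnd w c Y₂    = w ∧ not c
  XsAnd w c (X _) = true
  XsAnd w c _     = false

  XOnly : V → Bool
  XOnly (X _) = true
  XOnly _     = false

  Z₂Y₂Clique : V → Bool
  Z₂Y₂Clique Z₂ = true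
  Z₂Y₂Clique v  = Y₂Clique v

  another : ℕ → ℕ
  another zero    = 1
  another (suc _) = 0

  another≢ : ∀ k → another k ≢ k
  another≢ zero    ()
  another≢ (suc k) ()

  X-injective : ∀ {i j : Fin (2 * m)} → _≡_ {A = V} (X i) (X j) → i ≡ j
  X-injective refl = refl

  module _ (1<m : 1 < m) where

    0<m : 0 < m
    0<m = ≤-trans (s≤s z≤n) 1<m

    another<m : ∀ k → another k < m
    another<m zero    = 1<m
    another<m (suc k) = ≤-trans (s≤s z≤n) 1<m

    -- The partner of x_a dominates R - X a, and so does any other pair {c₀, c₁}.
    XsAnd-minus-x-¬wellCovered : ∀ a {w R} → R ≐ XsAnd w (not (parity a)) → ¬ WellCovered (P-adj m) (R - X a)
    XsAnd-minus-x-¬wellCovered a {w} {R} R≐ = dominating-vertex-and-pair⇒¬wellCovered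
      partner∈S (⊆-≐ S≐ (N[]-≐ (X partner)) dominated-by-partner) c₀∈S c₁∈S (a≢a′ ∘ X-injective) (subst T a≁a′)
      (⊆-≐ S≐ (∪-≐ (N[]-≐ (X c₀)) (N[]-≐ (X c₁))) dominated-by-c)
      where
      S≐ : R - X a ≐ λ v → not (does (v ≟ X a)) ∧ XsAnd w (not (parity a)) v
      S≐ = -≐ (X a) R≐

      module Mate = PairFacts (parity a) (pair a) (pair<m a)

      partner : Fin (2 * m)
      partner = Mate.a′

      a≡Mate-a : a ≡ Mate.a
      a≡Mate-a = member-unique (pair<m a) a refl refl

      k : ℕ
      k = another (pair a)

      k<m : k < m
      k<m = another<m (pair a)

      open PairFacts true k k<m using (a≢a′; a≁a′) renaming (a to c₀; a′ to c₁)
      module Other = PairFacts true k k<m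

      ∈S : ∀ {i} → i ≢ a → X i ∈ R - X a
      ∈S {i} i≢a = ≐⇒∈ S≐ (subst (λ e → T (not e ∧ true)) (sym (dec-false (i ≟ a) i≢a)) _)

      partner∈S : X partner ∈ R - X a
      partner∈S = ∈S λ partner≡a → Mate.a′≢a (trans partner≡a a≡Mate-a)

      c₀∈S : X c₀ ∈ R - X a
      c₀∈S = ∈S λ c₀≡a → another≢ (pair a) (trans (sym (pair-member k true k<m)) (cong pair c₀≡a))

      c₁∈S : X c₁ ∈ R - X a
      c₁∈S = ∈S λ c₁≡a → another≢ (pair a) (trans (sym (pair-member k false k<m)) (cong pair c₁≡a))

      parity-partner : parity partner ≡ not (parity a)
      parity-partner = parity-member (pair a) (not (parity a)) (pair<m a)

      dominated-by-partner : ∀ v → T (not (does (v ≟ X a)) ∧ XsAnd w (not (parity a)) v) →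
                             T (does (v ≟ X partner) ∨ P-adj m (X partner) v)
      dominated-by-partner Y₁ t = subst T (sym parity-partner) (proj₂ (Equivalence.to T-∧ t))
      dominated-by-partner Y₂ t = subst (T ∘ not) (sym parity-partner) (proj₂ (Equivalence.to T-∧ t))
      dominated-by-partner (X i) t with position (pair a) (parity a) (pair<m a) i
      ... | before lt rewrite Mate.i≟a′ i (<⇒≢ lt) | Mate.a′~i i (<⇒≢ lt) = _
      ... | this = ⊥-elim (subst (λ e → T (not e ∧ true)) (dec-true (Mate.a ≟ a) (sym a≡Mate-a)) t)
      ... | mate rewrite Mate.a′≟a′ = _
      ... | after gt rewrite Mate.i≟a′ i (>⇒≢ gt) | Mate.a′~i i (>⇒≢ gt) = _

      dominated-by-c : ∀ v → T (not (does (v ≟ X a)) ∧ XsAnd w (not (parity a)) v) →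
                       T ((does (v ≟ X c₀) ∨ P-adj m (X c₀) v) ∨ (does (v ≟ X c₁) ∨ P-adj m (X c₁) v))
      dominated-by-c Y₁ _ rewrite parity-member k true k<m = _
      dominated-by-c Y₂ _ rewrite parity-member k true k<m | parity-member k false k<m = _
      dominated-by-c (X i) _ with position k true k<m i
      ... | before i<k rewrite Other.i≟a i (<⇒≢ i<k) | Other.a~i i (<⇒≢ i<k) = _
      ... | this rewrite Other.a≟a = _
      ... | mate rewrite Other.a′≟a | Other.a≁a′ | Other.a′≟a′ = _
      ... | after k<i  rewrite Other.i≟a i (>⇒≢ k<i) | Other.a~i i (>⇒≢ k<i) = _

    XOnly-¬VD : ∀ {R} → R ≐ XOnly → ¬ VD R
    XOnly-¬VD R≐ (vd-empty _ no-edges) =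
      no-edges (X x₀) (X x₁) (≐⇒∈ R≐ _) (≐⇒∈ R≐ _) (subst T (sym (adjK-other-pair x₀ x₁ pairs-differ)) _)
      where
      x₀ x₁ : Fin (2 * m)
      x₀ = member 0 true 0<m
      x₁ = member 1 true 1<m
      pairs-differ : pair x₀ ≢ pair x₁
      pairs-differ same with () ← trans (sym (pair-member 0 true 0<m)) (trans same (pair-member 1 true 1<m))
    XOnly-¬VD {R} R≐ (vd-shed _ v v∈R vd₁ _) with v | vd₁ | ∈⇒≐ R≐ v∈R
    ... | X a | vd₁ | _ = XsAnd-minus-x-¬wellCovered a
      (≐-≗ R≐ λ { Z₁ → refl ; Z₂ → refl ; Z₃ → refl ; Y₁ → refl ; Y₂ → refl ; (X _) → refl })
      (VD⇒wellCovered vd₁)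

    ⊤-y-¬VD : ∀ b → ¬ VD (⊤ - Y b)
    ⊤-y-¬VD b vd = XOnly-¬VD (≐-≗ (─N[]-≐ (Z (not b)) (-≐ (Y b) ⊤-≐)) (by-vertex b))
      (VD-─N[] {x = Z (not b)} vd (x∈p∧x≢y⇒x∈p-y ∈⊤ (z≢y b)))
      where
      z≢y : ∀ b → Z (not b) ≢ Y b
      z≢y true  ()
      z≢y false ()
      by-vertex : ∀ b → (λ v → not (does (v ≟ Z (not b)) ∨ P-adj m (Z (not b)) v) ∧ (not (does (v ≟ Y b)) ∧ true))
                        ≗ XOnly
      by-vertex true  = λ { Z₁ → refl ; Z₂ → refl ; Z₃ → refl ; Y₁ → refl ; Y₂ → refl ; (X _) → refl }
      by-vertex false = λ { Z₁ → refl ; Z₂ → refl ; Z₃ → refl ; Y₁ → refl ; Y₂ → refl ; (X _) → refl }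

    ⊤-x-¬VD : ∀ a → ¬ VD (⊤ - X a)
    ⊤-x-¬VD a vd = XsAnd-minus-x-¬wellCovered a (≐-≗ (⊤─N[z]≐Tail (parity a))
        λ { Z₁ → refl ; Z₂ → refl ; Z₃ → refl ; Y₁ → refl ; Y₂ → refl ; (X _) → refl })
      (VD⇒wellCovered (subst VD (p─q─r≡p─r─q ⊤ ⁅ X a ⁆ N[ Z (parity a) ])
        (VD-─N[] {x = Z (parity a)} vd (x∈p∧x≢y⇒x∈p-y ∈⊤ (z≢x (parity a))))))
      where
      z≢x : ∀ c → Z c ≢ X a
      z≢x true  ()
      z≢x false ()

    ⊤-z₃-¬VD : ¬ VD (⊤ - Z₃)
    ⊤-z₃-¬VD vd = dominating-vertex-and-pair⇒¬wellCovered {x = Y₂} {u = Z₂} {w = X x₀}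
      (≐⇒∈ S≐ _) (⊆-≐ S≐ (N[]-≐ Y₂) dominated-by-y₂)
      (≐⇒∈ S≐ _) (≐⇒∈ S≐ (subst (T ∘ not) (sym (parity-member 0 false 0<m)) _)) (λ ()) (λ ())
      (⊆-≐ S≐ (∪-≐ (N[]-≐ Z₂) (N[]-≐ (X x₀))) dominated-by-z₂-x₀)
      (VD⇒wellCovered (VD-─N[] {x = Y₁} vd (x∈p∧x≢y⇒x∈p-y {y = Z₃} ∈⊤ λ ())))
      where
      open PairFacts false 0 0<m using (a≟a; i≟a; a~i) renaming (a to x₀)
      S≐ : ⊤ - Z₃ ─ N[ Y₁ ] ≐ Z₂Y₂Clique
      S≐ = ≐-≗ (─N[]-≐ Y₁ (-≐ Z₃ ⊤-≐))
        λ { Z₁ → refl ; Z₂ → refl ; Z₃ → refl ; Y₁ → refl ; Y₂ → refl ; (X _) → ∧-identityʳ _ }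
      dominated-by-y₂ : ∀ v → T (Z₂Y₂Clique v) → T (does (v ≟ Y₂) ∨ P-adj m Y₂ v)
      dominated-by-y₂ Z₂    _ = _
      dominated-by-y₂ Y₂    _ = _
      dominated-by-y₂ (X i) t = t
      dominated-by-z₂-x₀ : ∀ v → T (Z₂Y₂Clique v) →
                           T ((does (v ≟ Z₂) ∨ P-adj m Z₂ v) ∨ (does (v ≟ X x₀) ∨ P-adj m (X x₀) v))
      dominated-by-z₂-x₀ Z₂ _ = _
      dominated-by-z₂-x₀ Y₂ _ = _
      dominated-by-z₂-x₀ (X i) t with position 0 false 0<m i
      ... | before ()
      ... | this rewrite a≟a = _
      ... | mate = ⊥-elim (subst (T ∘ not) (parity-member 0 true 0<m) t)
      ... | after 0<i rewrite i≟a i (>⇒≢ 0<i) | a~i i (>⇒≢ 0<i) = _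

theorem6p10 : (m : ℕ) → 2 ≤ m →
    VertexDecomposable (P-adj m) ⊤ ×
    ((v : Fin (5 + 2 * m)) → Shedding (P-adj m) ⊤ v ⇔ (v ≡ z₁ m ⊎ v ≡ z₂ m))
theorem6p10 (suc r) 1<m = proj₁ (⊤-decomposable r refl) , λ v → mk⇔ (shedding⇒z v) (z⇒shedding v)
  where
  open P (suc r)
  shedding⇒z : ∀ v → Shedding (P-adj (suc r)) ⊤ v → v ≡ Z₁ ⊎ v ≡ Z₂
  shedding⇒z Z₁    _            = inj₁ refl
  shedding⇒z Z₂    _            = inj₂ refl
  shedding⇒z Z₃    (_ , vd , _) = ⊥-elim (⊤-z₃-¬VD 1<m vd)
  shedding⇒z Y₁    (_ , vd , _) = ⊥-elim (⊤-y-¬VD 1<m true vd)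
  shedding⇒z Y₂    (_ , vd , _) = ⊥-elim (⊤-y-¬VD 1<m false vd)
  shedding⇒z (X a) (_ , vd , _) = ⊥-elim (⊤-x-¬VD 1<m a vd)
  z⇒shedding : ∀ v → v ≡ Z₁ ⊎ v ≡ Z₂ → Shedding (P-adj (suc r)) ⊤ v
  z⇒shedding _ (inj₁ refl) = z-shedding r refl true
  z⇒shedding _ (inj₂ refl) = z-shedding r refl false
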